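{- For every integer $n>3$, the circulant matrix $\operatorname{circ}(3,-1,0,\ldots,0,-1)$ of order $n$ is invertible and \[[\operatorname{circ}(3,-1,0,\ldots,0,-1)]^{ -1}=\operatorname{circ}(a_0,a_1,\ldots,a_{n-1}),\] where for $j=0,1,\ldots,n-1$, \[a_j=\frac{2^{n-j}}{\sqrt{5}}\left[\frac{(3-\sqrt{5})^j}{2^n-(3-\sqrt{5})^n}-\frac{(3+\sqrt{5})^j}{2^n-(3+\sqrt{5})^n}\right].\]
   Context: For real numbers $c_0,\ldots,c_{k-1}$, $\operatorname{circ}(c_0,c_1,\ldots,c_{k-1})$ denotes the $k\times k$ circulant matrix whose $(i,j)$-entry is $c_{(j-i)\bmod k}$. Thus $\operatorname{circ}(3,-1,0,\ldots,0,-1)$ has $3$ on the diagonal, $-1$ on the cyclic super- and sub-diagonals, and $0$ elsewhere. -}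

module Defs where

open import Data.Nat as ℕ using (ℕ; zero; suc; _∸_; _%_)
open import Data.Fin using (Fin; toℕ)
import Data.Fin as F
open import Data.Rational as ℚ using (ℚ; 0ℚ; 1ℚ)
open import Data.Rational.Properties using () renaming (_≟_ to _≟ℚ_)
open import Relation.Nullary using (yes; no)
open import Data.Integer using (+_)

ℚfromℕ : ℕ → ℚ
ℚfromℕ n = (+ n) ℚ./ 1

record ℚ√5 : Set where
  constructor _+_√5
  field
    re : ℚ
    im : ℚ
open ℚ√5 public

infixl 6 _⊕_ _⊖_
infixl 7 _⊗_

_⊕_ : ℚ√5 → ℚ√5 → ℚ√5
(a + b √5) ⊕ (c + d √5) = (a ℚ.+ c) + (b ℚ.+ d) √5

⊝_ : ℚ√5 → ℚ√5
⊝ (a + b √5) = (ℚ.- a) + (ℚ.- b) √5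

_⊖_ : ℚ√5 → ℚ√5 → ℚ√5
x ⊖ y = x ⊕ (⊝ y)

_⊗_ : ℚ√5 → ℚ√5 → ℚ√5
(a + b √5) ⊗ (c + d √5) =
  (a ℚ.* c ℚ.+ ℚfromℕ 5 ℚ.* (b ℚ.* d)) + (a ℚ.* d ℚ.+ b ℚ.* c) √5

ofℚ : ℚ → ℚ√5
ofℚ q = q + 0ℚ √5

ofℕ : ℕ → ℚ√5
ofℕ n = ofℚ (ℚfromℕ n)

zero√5 one√5 √5 : ℚ√5
zero√5 = 0ℚ + 0ℚ √5
one√5  = 1ℚ + 0ℚ √5
√5     = 0ℚ + 1ℚ √5

_^_ : ℚ√5 → ℕ → ℚ√5
x ^ zero  = one√5
x ^ suc k = x ⊗ (x ^ k)

-- Multiplicative inverse in ℚ(√5):  (a + b√5)⁻¹ = (a − b√5)/(a² − 5b²).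
-- Total, with the convention 0⁻¹ = 0 (a² − 5b² = 0 iff a = b = 0).
inv : ℚ√5 → ℚ√5
inv (a + b √5) with a ℚ.* a ℚ.- ℚfromℕ 5 ℚ.* (b ℚ.* b) ≟ℚ 0ℚ
... | yes _  = zero√5
... | no N≢0 = (a ℚ.* r) + (ℚ.- b ℚ.* r) √5
  where
    N = a ℚ.* a ℚ.- ℚfromℕ 5 ℚ.* (b ℚ.* b)
    r = ℚ.1/_ N {{ℚ.≢-nonZero N≢0}}

infixl 7 _⊘_
_⊘_ : ℚ√5 → ℚ√5 → ℚ√5
x ⊘ y = x ⊗ inv y

Matrix : ℕ → Set
Matrix n = Fin n → Fin n → ℚ√5

Σ : (n : ℕ) → (Fin n → ℚ√5) → ℚ√5
Σ zero    f = zero√5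
Σ (suc n) f = f F.zero ⊕ Σ n (λ i → f (F.suc i))

_·_ : ∀ {n} → Matrix n → Matrix n → Matrix n
_·_ {n} A B i j = Σ n (λ k → A i k ⊗ B k j)

identity : ∀ n → Matrix n
identity n i j with toℕ i ℕ.≟ toℕ j
... | yes _ = one√5
... | no  _ = zero√5

-- circ(c₀,…,c_{n−1}) : (i,j)-entry is c_{(j−i) mod n}
circ : (n : ℕ) → (ℕ → ℚ√5) → Matrix n
circ zero    c i j = zero√5
circ (suc m) c i j = c (((suc m ℕ.+ toℕ j) ∸ toℕ i) % suc m)

row3 : ℕ → ℕ → ℚ√5
row3 n k with k ℕ.≟ 0
... | yes _ = ofℕ 3
... | no _ with k ℕ.≟ 1
...   | yes _ = ⊝ one√5
...   | no _ with k ℕ.≟ (n ∸ 1)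
...     | yes _ = ⊝ one√5
...     | no _  = zero√5

φ₋ φ₊ : ℚ√5
φ₋ = ofℕ 3 ⊖ √5
φ₊ = ofℕ 3 ⊕ √5

coeff : ℕ → ℕ → ℚ√5
coeff n j =
  ((ofℕ 2 ^ (n ∸ j)) ⊘ √5) ⊗
    ((φ₋ ^ j) ⊘ ((ofℕ 2 ^ n) ⊖ (φ₋ ^ n)) ⊖ (φ₊ ^ j) ⊘ ((ofℕ 2 ^ n) ⊖ (φ₊ ^ n)))

-- Write φ± = 3 ± √5; these are the roots of x² − 6x + 4, so every sequence
-- 2^(n−j) φ±^j satisfies u_j + u_(j+2) = 3 u_(j+1), and hence so does a_j for
-- 0 ≤ j ≤ n − 2. The factors 1/(2ⁿ − φ±ⁿ) are chosen so that a_n = a_0 and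
-- 3 a_0 − a_1 − a_(n−1) = 1. The product of two circulant matrices is the circulant
-- of the cyclic convolution of their first rows, and convolving (3, −1, 0, …, 0, −1)
-- with (a_j) gives 3 a_d − a_(d−1) − a_(d+1) = [d = 0] (indices mod n); since cyclic
-- convolution is commutative this settles both products. The denominators are
-- nonzero because the norm N(a + b√5) = a² − 5b² is multiplicative with
-- N(φ±) = 4 = N(2), so N(2ⁿ − φ±ⁿ) = 2·2ⁿ (2ⁿ − Re φ±ⁿ) < 0 as Re φ±ⁿ > 2ⁿ for n ≥ 1.

module Submission where

open import Defs
open import Algebra.Bundles using (CommutativeRing)
import Algebra.Consequences.Setoid as Consequences
import Algebra.Properties.Group as GroupProperties
open import Algebra.Structures using (IsCommutativeRing)
open import Data.Fin using (Fin; toℕ)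
import Data.Fin.Properties as Fin
open import Data.Nat using (ℕ; zero; suc; _<_; _≤_; _∸_; _%_; z≤n; s≤s; z<s; s<s)
import Data.Nat as ℕ
open import Data.Nat.DivMod
import Data.Nat.Properties as ℕ
open import Data.Nat.Tactic.RingSolver using () renaming (ring to ℕ-ring)
open import Data.Product using (_×_; _,_; proj₁; proj₂)
open import Data.Rational as ℚ using (ℚ; 0ℚ; 1ℚ)
import Data.Rational.Properties as ℚ
open import Data.Sum using ([_,_]′)
open import Function using (_∘_)
open import Level using (0ℓ)
open import Relation.Binary.PropositionalEquality
  using (_≡_; _≢_; refl; sym; trans; cong; cong₂; subst; subst₂; setoid; isEquivalence; module ≡-Reasoning)
open import Relation.Nullary using (yes; no; contradiction)
open import Relation.Nullary.Decidable using (Dec; dec⇒maybe; map′; _×-dec_)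
open import Tactic.RingSolver using (solve-∀)
open import Tactic.RingSolver.Core.AlmostCommutativeRing using (AlmostCommutativeRing; fromCommutativeRing)

-- The field ℚ(√5)

ℚ-ring : AlmostCommutativeRing 0ℓ 0ℓ
ℚ-ring = fromCommutativeRing ℚ.+-*-commutativeRing (λ x → dec⇒maybe (0ℚ ℚ.≟ x))

√5-cong : ∀ {a b c d} → a ≡ c → b ≡ d → (a + b √5) ≡ (c + d √5)
√5-cong = cong₂ _+_√5

five : ℚ
five = ℚfromℕ 5

⊕-comm : ∀ x y → x ⊕ y ≡ y ⊕ x
⊕-comm (a + b √5) (c + d √5) = √5-cong (ℚ.+-comm a c) (ℚ.+-comm b d)

⊕-assoc : ∀ x y z → (x ⊕ y) ⊕ z ≡ x ⊕ (y ⊕ z)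
⊕-assoc (a + b √5) (c + d √5) (e + f √5) = √5-cong (ℚ.+-assoc a c e) (ℚ.+-assoc b d f)

⊕-identityˡ : ∀ x → zero√5 ⊕ x ≡ x
⊕-identityˡ (a + b √5) = √5-cong (ℚ.+-identityˡ a) (ℚ.+-identityˡ b)

⊝-inverseʳ : ∀ x → x ⊕ (⊝ x) ≡ zero√5
⊝-inverseʳ (a + b √5) = √5-cong (ℚ.+-inverseʳ a) (ℚ.+-inverseʳ b)

⊗-comm : ∀ x y → x ⊗ y ≡ y ⊗ x
⊗-comm (a + b √5) (c + d √5) = √5-cong (re-comm a b c d) (im-comm a b c d)
  where
  re-comm : ∀ a b c d → a ℚ.* c ℚ.+ five ℚ.* (b ℚ.* d) ≡ c ℚ.* a ℚ.+ five ℚ.* (d ℚ.* b)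
  re-comm = solve-∀ ℚ-ring
  im-comm : ∀ a b c d → a ℚ.* d ℚ.+ b ℚ.* c ≡ c ℚ.* b ℚ.+ d ℚ.* a
  im-comm = solve-∀ ℚ-ring

⊗-assoc : ∀ x y z → (x ⊗ y) ⊗ z ≡ x ⊗ (y ⊗ z)
⊗-assoc (a + b √5) (c + d √5) (e + f √5) = √5-cong (re-assoc a b c d e f) (im-assoc a b c d e f)
  where
  re-assoc : ∀ a b c d e f →
    (a ℚ.* c ℚ.+ five ℚ.* (b ℚ.* d)) ℚ.* e ℚ.+ five ℚ.* ((a ℚ.* d ℚ.+ b ℚ.* c) ℚ.* f)
      ≡ a ℚ.* (c ℚ.* e ℚ.+ five ℚ.* (d ℚ.* f)) ℚ.+ five ℚ.* (b ℚ.* (c ℚ.* f ℚ.+ d ℚ.* e))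
  re-assoc = solve-∀ ℚ-ring
  im-assoc : ∀ a b c d e f →
    (a ℚ.* c ℚ.+ five ℚ.* (b ℚ.* d)) ℚ.* f ℚ.+ (a ℚ.* d ℚ.+ b ℚ.* c) ℚ.* e
      ≡ a ℚ.* (c ℚ.* f ℚ.+ d ℚ.* e) ℚ.+ b ℚ.* (c ℚ.* e ℚ.+ five ℚ.* (d ℚ.* f))
  im-assoc = solve-∀ ℚ-ring

⊗-identityˡ : ∀ x → one√5 ⊗ x ≡ x
⊗-identityˡ (a + b √5) = √5-cong (re-identity a b) (im-identity a b)
  where
  re-identity : ∀ a b → 1ℚ ℚ.* a ℚ.+ five ℚ.* (0ℚ ℚ.* b) ≡ a
  re-identity = solve-∀ ℚ-ring
  im-identity : ∀ a b → 1ℚ ℚ.* b ℚ.+ 0ℚ ℚ.* a ≡ b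
  im-identity = solve-∀ ℚ-ring

⊗-distribʳ : ∀ x y z → (y ⊕ z) ⊗ x ≡ (y ⊗ x) ⊕ (z ⊗ x)
⊗-distribʳ (a + b √5) (c + d √5) (e + f √5) = √5-cong (re-distrib a b c d e f) (im-distrib a b c d e f)
  where
  re-distrib : ∀ a b c d e f →
    (c ℚ.+ e) ℚ.* a ℚ.+ five ℚ.* ((d ℚ.+ f) ℚ.* b)
      ≡ (c ℚ.* a ℚ.+ five ℚ.* (d ℚ.* b)) ℚ.+ (e ℚ.* a ℚ.+ five ℚ.* (f ℚ.* b))
  re-distrib = solve-∀ ℚ-ring
  im-distrib : ∀ a b c d e f →
    (c ℚ.+ e) ℚ.* b ℚ.+ (d ℚ.+ f) ℚ.* a ≡ (c ℚ.* b ℚ.+ d ℚ.* a) ℚ.+ (e ℚ.* b ℚ.+ f ℚ.* a)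
  im-distrib = solve-∀ ℚ-ring

open Consequences (setoid ℚ√5) using (comm∧idˡ⇒id; comm∧invʳ⇒inv; comm∧distrʳ⇒distr)

ℚ√5-isCommutativeRing : IsCommutativeRing _≡_ _⊕_ _⊗_ ⊝_ zero√5 one√5
ℚ√5-isCommutativeRing = record
  { isRing = record
    { +-isAbelianGroup = record
      { isGroup = record
        { isMonoid = record
          { isSemigroup = record
            { isMagma = record { isEquivalence = isEquivalence ; ∙-cong = cong₂ _⊕_ }
            ; assoc = ⊕-assoc }
          ; identity = comm∧idˡ⇒id ⊕-comm ⊕-identityˡ }
        ; inverse = comm∧invʳ⇒inv ⊕-comm ⊝-inverseʳ
        ; ⁻¹-cong = cong ⊝_ }
      ; comm = ⊕-comm }
    ; *-cong = cong₂ _⊗_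
    ; *-assoc = ⊗-assoc
    ; *-identity = comm∧idˡ⇒id ⊗-comm ⊗-identityˡ
    ; distrib = comm∧distrʳ⇒distr (cong₂ _⊕_) ⊗-comm ⊗-distribʳ }
  ; *-comm = ⊗-comm }

ℚ√5-commutativeRing : CommutativeRing 0ℓ 0ℓ
ℚ√5-commutativeRing = record { isCommutativeRing = ℚ√5-isCommutativeRing }

_≟_ : (x y : ℚ√5) → Dec (x ≡ y)
(a + b √5) ≟ (c + d √5) =
  map′ (λ (p , q) → √5-cong p q) (λ p → cong re p , cong im p) ((a ℚ.≟ c) ×-dec (b ℚ.≟ d))

-- The solver treats closed subterms such as φ₋ or inv √5 as constants and evaluates
-- them, so it also proves identities that depend on their values (φ₋ ⊗ φ₊ = 4, …).
ℚ√5-ring : AlmostCommutativeRing 0ℓ 0ℓ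
ℚ√5-ring = fromCommutativeRing ℚ√5-commutativeRing (λ x → dec⇒maybe (zero√5 ≟ x))

norm : ℚ√5 → ℚ
norm (a + b √5) = a ℚ.* a ℚ.- five ℚ.* (b ℚ.* b)

norm-⊗ : ∀ x y → norm (x ⊗ y) ≡ norm x ℚ.* norm y
norm-⊗ (a + b √5) (c + d √5) = norm-mult a b c d
  where
  norm-mult : ∀ a b c d →
    (a ℚ.* c ℚ.+ five ℚ.* (b ℚ.* d)) ℚ.* (a ℚ.* c ℚ.+ five ℚ.* (b ℚ.* d))
      ℚ.- five ℚ.* ((a ℚ.* d ℚ.+ b ℚ.* c) ℚ.* (a ℚ.* d ℚ.+ b ℚ.* c))
    ≡ (a ℚ.* a ℚ.- five ℚ.* (b ℚ.* b)) ℚ.* (c ℚ.* c ℚ.- five ℚ.* (d ℚ.* d))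
  norm-mult = solve-∀ ℚ-ring

norm-^-cong : ∀ {x y} → norm x ≡ norm y → ∀ n → norm (x ^ n) ≡ norm (y ^ n)
norm-^-cong eq zero    = refl
norm-^-cong {x} {y} eq (suc n) = begin
  norm (x ⊗ x ^ n)           ≡⟨ norm-⊗ x (x ^ n) ⟩
  norm x ℚ.* norm (x ^ n)    ≡⟨ cong₂ ℚ._*_ eq (norm-^-cong eq n) ⟩
  norm y ℚ.* norm (y ^ n)    ≡⟨ norm-⊗ y (y ^ n) ⟨
  norm (y ⊗ y ^ n)           ∎
  where open ≡-Reasoning

⊗-inverseʳ : ∀ x → norm x ≢ 0ℚ → x ⊗ inv x ≡ one√5
⊗-inverseʳ (a + b √5) N≢0 with norm (a + b √5) ℚ.≟ 0ℚ
... | yes N≡0 = contradiction N≡0 N≢0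
... | no N≢0′ = √5-cong (trans (re-inverse a b r) (ℚ.*-inverseʳ N {{ℚ.≢-nonZero N≢0′}})) (im-inverse a b r)
  where
  N = norm (a + b √5)
  r = ℚ.1/_ N {{ℚ.≢-nonZero N≢0′}}
  re-inverse : ∀ a b r →
    a ℚ.* (a ℚ.* r) ℚ.+ five ℚ.* (b ℚ.* (ℚ.- b ℚ.* r)) ≡ (a ℚ.* a ℚ.- five ℚ.* (b ℚ.* b)) ℚ.* r
  re-inverse = solve-∀ ℚ-ring
  im-inverse : ∀ a b r → a ℚ.* (ℚ.- b ℚ.* r) ℚ.+ b ℚ.* (a ℚ.* r) ≡ 0ℚ
  im-inverse = solve-∀ ℚ-ring

norm-negative⇒≢0 : ∀ {x} → norm x ℚ.< 0ℚ → x ≢ zero√5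
norm-negative⇒≢0 N<0 x≡0 = ℚ.<-irrefl (cong norm x≡0) N<0

conj : ℚ√5 → ℚ√5
conj (a + b √5) = a + (ℚ.- b) √5

conj-⊗ : ∀ x y → conj (x ⊗ y) ≡ conj x ⊗ conj y
conj-⊗ (a + b √5) (c + d √5) = √5-cong (re-conj a b c d) (im-conj a b c d)
  where
  re-conj : ∀ a b c d →
    a ℚ.* c ℚ.+ five ℚ.* (b ℚ.* d) ≡ a ℚ.* c ℚ.+ five ℚ.* (ℚ.- b ℚ.* ℚ.- d)
  re-conj = solve-∀ ℚ-ring
  im-conj : ∀ a b c d → ℚ.- (a ℚ.* d ℚ.+ b ℚ.* c) ≡ a ℚ.* ℚ.- d ℚ.+ ℚ.- b ℚ.* c
  im-conj = solve-∀ ℚ-ring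

conj-^ : ∀ x n → conj (x ^ n) ≡ conj x ^ n
conj-^ x zero    = refl
conj-^ x (suc n) = trans (conj-⊗ x (x ^ n)) (cong (conj x ⊗_) (conj-^ x n))

re-φ₋^ : ∀ n → re (φ₋ ^ n) ≡ re (φ₊ ^ n)
re-φ₋^ n = cong re (sym (conj-^ φ₊ n))

norm-ofℚ-⊖ : ∀ t x → norm x ≡ t ℚ.* t → norm (ofℚ t ⊖ x) ≡ (t ℚ.+ t) ℚ.* (t ℚ.- re x)
norm-ofℚ-⊖ t (a + b √5) Nx = begin
  norm (ofℚ t ⊖ (a + b √5))                              ≡⟨ expand t a b ⟩
  (t ℚ.+ t) ℚ.* (t ℚ.- a) ℚ.+ (norm (a + b √5) ℚ.- t ℚ.* t)
    ≡⟨ cong (λ N → (t ℚ.+ t) ℚ.* (t ℚ.- a) ℚ.+ (N ℚ.- t ℚ.* t)) Nx ⟩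
  (t ℚ.+ t) ℚ.* (t ℚ.- a) ℚ.+ (t ℚ.* t ℚ.- t ℚ.* t)
    ≡⟨ cancel ((t ℚ.+ t) ℚ.* (t ℚ.- a)) (t ℚ.* t) ⟩
  (t ℚ.+ t) ℚ.* (t ℚ.- a)                                ∎
  where
  open ≡-Reasoning
  expand : ∀ t a b →
    (t ℚ.+ ℚ.- a) ℚ.* (t ℚ.+ ℚ.- a) ℚ.- five ℚ.* ((0ℚ ℚ.+ ℚ.- b) ℚ.* (0ℚ ℚ.+ ℚ.- b))
      ≡ (t ℚ.+ t) ℚ.* (t ℚ.- a) ℚ.+ ((a ℚ.* a ℚ.- five ℚ.* (b ℚ.* b)) ℚ.- t ℚ.* t)
  expand = solve-∀ ℚ-ring
  cancel : ∀ u v → u ℚ.+ (v ℚ.- v) ≡ u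
  cancel = solve-∀ ℚ-ring

-- The denominators 2ⁿ − φ±ⁿ

three : ℚ
three = ℚfromℕ 3

2⊗x≡x⊕x : ∀ x → ofℕ 2 ⊗ x ≡ x ⊕ x
2⊗x≡x⊕x = solve-∀ ℚ√5-ring

φ₊⊗-coordinates : ∀ a b → φ₊ ⊗ (a + b √5) ≡ (three ℚ.* a ℚ.+ five ℚ.* b) + (three ℚ.* b ℚ.+ a) √5
φ₊⊗-coordinates a b = √5-cong (re-φ₊⊗ a b) (im-φ₊⊗ a b)
  where
  re-φ₊⊗ : ∀ a b → re φ₊ ℚ.* a ℚ.+ five ℚ.* (im φ₊ ℚ.* b) ≡ three ℚ.* a ℚ.+ five ℚ.* b
  re-φ₊⊗ = solve-∀ ℚ-ring
  im-φ₊⊗ : ∀ a b → re φ₊ ℚ.* b ℚ.+ im φ₊ ℚ.* a ≡ three ℚ.* b ℚ.+ a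
  im-φ₊⊗ = solve-∀ ℚ-ring

2^-im : ∀ n → im (ofℕ 2 ^ n) ≡ 0ℚ
2^-im zero    = refl
2^-im (suc n) = trans (cong im (2⊗x≡x⊕x (ofℕ 2 ^ n))) (cong (λ b → b ℚ.+ b) (2^-im n))

2^-real : ∀ n → ofℕ 2 ^ n ≡ ofℚ (re (ofℕ 2 ^ n))
2^-real n = cong (re (ofℕ 2 ^ n) +_√5) (2^-im n)

norm-2^ : ∀ n → norm (ofℕ 2 ^ n) ≡ re (ofℕ 2 ^ n) ℚ.* re (ofℕ 2 ^ n)
norm-2^ n = trans (cong norm (2^-real n)) (norm-real (re (ofℕ 2 ^ n)))
  where
  norm-real : ∀ t → t ℚ.* t ℚ.- five ℚ.* (0ℚ ℚ.* 0ℚ) ≡ t ℚ.* t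
  norm-real = solve-∀ ℚ-ring

φ₊-growth-step : ∀ {t p q} → 0ℚ ℚ.< t → t ℚ.≤ p → 0ℚ ℚ.≤ q →
          t ℚ.+ t ℚ.< three ℚ.* p ℚ.+ five ℚ.* q × 0ℚ ℚ.≤ three ℚ.* q ℚ.+ p
φ₊-growth-step {t} {p} {q} 0<t t≤p 0≤q = t+t<p′ , 0≤q′
  where
  open ℚ.≤-Reasoning
  instance
    _ = ℚ.positive (ℚ.<-≤-trans 0<t t≤p)
    _ = ℚ.nonNegative 0≤q
    _ = ℚ.nonNeg*nonNeg⇒nonNeg five q
    _ = ℚ.nonNeg*nonNeg⇒nonNeg three q
    _ = ℚ.pos⇒nonNeg p
  0<p+5q : 0ℚ ℚ.< p ℚ.+ five ℚ.* q
  0<p+5q = ℚ.positive⁻¹ _ {{ℚ.pos+nonNeg⇒pos p (five ℚ.* q)}}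
  split : ∀ p q → three ℚ.* p ℚ.+ five ℚ.* q ≡ (p ℚ.+ p) ℚ.+ (p ℚ.+ five ℚ.* q)
  split = solve-∀ ℚ-ring
  t+t<p′ : t ℚ.+ t ℚ.< three ℚ.* p ℚ.+ five ℚ.* q
  t+t<p′ = begin-strict
    t ℚ.+ t                           ≤⟨ ℚ.+-mono-≤ t≤p t≤p ⟩
    p ℚ.+ p                           ≡⟨ ℚ.+-identityʳ (p ℚ.+ p) ⟨
    (p ℚ.+ p) ℚ.+ 0ℚ                  <⟨ ℚ.+-monoʳ-< (p ℚ.+ p) 0<p+5q ⟩
    (p ℚ.+ p) ℚ.+ (p ℚ.+ five ℚ.* q)  ≡⟨ split p q ⟨
    three ℚ.* p ℚ.+ five ℚ.* q        ∎
  0≤q′ : 0ℚ ℚ.≤ three ℚ.* q ℚ.+ p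
  0≤q′ = ℚ.nonNegative⁻¹ _ {{ℚ.nonNeg+nonNeg⇒nonNeg (three ℚ.* q) p}}

re-2^-suc : ∀ n → re (ofℕ 2 ^ suc n) ≡ re (ofℕ 2 ^ n) ℚ.+ re (ofℕ 2 ^ n)
re-2^-suc n = cong re (2⊗x≡x⊕x (ofℕ 2 ^ n))

re-2^-positive : ∀ n → 0ℚ ℚ.< re (ofℕ 2 ^ n)
re-2^-positive zero    = ℚ.positive⁻¹ 1ℚ
re-2^-positive (suc n) =
  subst (0ℚ ℚ.<_) (sym (re-2^-suc n)) (ℚ.+-mono-< (re-2^-positive n) (re-2^-positive n))

φ₊^-growth : ∀ n → re (ofℕ 2 ^ n) ℚ.≤ re (φ₊ ^ n) × 0ℚ ℚ.≤ im (φ₊ ^ n)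
2^<φ₊^ : ∀ n → re (ofℕ 2 ^ suc n) ℚ.< re (φ₊ ^ suc n)

φ₊^-growth zero    = ℚ.≤-refl , ℚ.≤-refl
φ₊^-growth (suc n) with φ₊^-growth n
... | t≤p , 0≤q =
  ℚ.<⇒≤ (2^<φ₊^ n) ,
  subst (0ℚ ℚ.≤_) (sym (cong im (φ₊⊗-coordinates (re (φ₊ ^ n)) (im (φ₊ ^ n)))))
    (proj₂ (φ₊-growth-step (re-2^-positive n) t≤p 0≤q))

2^<φ₊^ n with φ₊^-growth n
... | t≤p , 0≤q =
  subst₂ ℚ._<_ (sym (re-2^-suc n)) (sym (cong re (φ₊⊗-coordinates (re (φ₊ ^ n)) (im (φ₊ ^ n)))))
    (proj₁ (φ₊-growth-step (re-2^-positive n) t≤p 0≤q))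

norm-2^⊖φ^-negative : ∀ {φ} → norm φ ≡ norm (ofℕ 2) → ∀ n →
                      re (ofℕ 2 ^ n) ℚ.< re (φ ^ n) → norm (ofℕ 2 ^ n ⊖ φ ^ n) ℚ.< 0ℚ
norm-2^⊖φ^-negative {φ} Nφ n t<p = begin-strict
  norm (ofℕ 2 ^ n ⊖ φ ^ n)           ≡⟨ cong (λ x → norm (x ⊖ φ ^ n)) (2^-real n) ⟩
  norm (ofℚ t ⊖ φ ^ n)               ≡⟨ norm-ofℚ-⊖ t (φ ^ n) (trans (norm-^-cong Nφ n) (norm-2^ n)) ⟩
  (t ℚ.+ t) ℚ.* (t ℚ.- re (φ ^ n))   <⟨ ℚ.*-monoʳ-<-pos (t ℚ.+ t) t-p<0 ⟩
  (t ℚ.+ t) ℚ.* 0ℚ                   ≡⟨ ℚ.*-zeroʳ (t ℚ.+ t) ⟩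
  0ℚ                                 ∎
  where
  open ℚ.≤-Reasoning
  t = re (ofℕ 2 ^ n)
  instance
    _ = ℚ.positive (ℚ.+-mono-< (re-2^-positive n) (re-2^-positive n))
  t-p<0 : t ℚ.- re (φ ^ n) ℚ.< 0ℚ
  t-p<0 = subst (t ℚ.- re (φ ^ n) ℚ.<_) (ℚ.+-inverseʳ (re (φ ^ n))) (ℚ.+-monoˡ-< (ℚ.- re (φ ^ n)) t<p)

norm-2^⊖φ₊^-negative : ∀ n → norm (ofℕ 2 ^ suc n ⊖ φ₊ ^ suc n) ℚ.< 0ℚ
norm-2^⊖φ₊^-negative n = norm-2^⊖φ^-negative {φ₊} refl (suc n) (2^<φ₊^ n)

norm-2^⊖φ₋^-negative : ∀ n → norm (ofℕ 2 ^ suc n ⊖ φ₋ ^ suc n) ℚ.< 0ℚ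
norm-2^⊖φ₋^-negative n = norm-2^⊖φ^-negative {φ₋} refl (suc n)
  (subst (re (ofℕ 2 ^ suc n) ℚ.<_) (sym (re-φ₋^ (suc n))) (2^<φ₊^ n))

α β : ℕ → ℚ√5
α n = inv (ofℕ 2 ^ n ⊖ φ₋ ^ n)
β n = inv (ofℕ 2 ^ n ⊖ φ₊ ^ n)

-- coeff n j is coeff′ (α n) (β n) (n ∸ j) j by definition; decoupling the power of 2
-- from j keeps truncated subtraction out of the recurrences.
coeff′ : ℚ√5 → ℚ√5 → ℕ → ℕ → ℚ√5
coeff′ a b e j = ((ofℕ 2 ^ e) ⊘ √5) ⊗ ((φ₋ ^ j) ⊗ a ⊖ (φ₊ ^ j) ⊗ b)

coeff′-recurrence : ∀ a b e j →
  ofℕ 3 ⊗ coeff′ a b (suc e) (suc j) ⊖ coeff′ a b (2 ℕ.+ e) j ⊖ coeff′ a b e (2 ℕ.+ j) ≡ zero√5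
coeff′-recurrence a b e j = recurrence (ofℕ 2 ^ e) (φ₋ ^ j) (φ₊ ^ j) a b
  where
  s = inv √5
  recurrence : ∀ t P Q a b →
    ofℕ 3 ⊗ (((ofℕ 2 ⊗ t) ⊗ s) ⊗ ((φ₋ ⊗ P) ⊗ a ⊖ (φ₊ ⊗ Q) ⊗ b))
      ⊖ ((ofℕ 2 ⊗ (ofℕ 2 ⊗ t)) ⊗ s) ⊗ (P ⊗ a ⊖ Q ⊗ b)
      ⊖ (t ⊗ s) ⊗ ((φ₋ ⊗ (φ₋ ⊗ P)) ⊗ a ⊖ (φ₊ ⊗ (φ₊ ⊗ Q)) ⊗ b)
    ≡ zero√5
  recurrence = solve-∀ ℚ√5-ring

coeff′-periodic : ∀ n → (ofℕ 2 ^ n ⊖ φ₋ ^ n) ⊗ α n ≡ one√5 → (ofℕ 2 ^ n ⊖ φ₊ ^ n) ⊗ β n ≡ one√5 →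
                  coeff′ (α n) (β n) 0 n ≡ coeff′ (α n) (β n) n 0
coeff′-periodic n Aα Bβ = begin
  coeff′ (α n) (β n) 0 n                   ≡⟨ split (ofℕ 2 ^ n) (φ₋ ^ n) (φ₊ ^ n) (α n) (β n) ⟩
  a₀ ⊖ s ⊗ (A ⊗ α n ⊖ B ⊗ β n)             ≡⟨ cong₂ (λ u v → a₀ ⊖ s ⊗ (u ⊖ v)) Aα Bβ ⟩
  a₀ ⊖ s ⊗ (one√5 ⊖ one√5)                 ≡⟨ vanish a₀ ⟩
  a₀                                       ∎
  where
  open ≡-Reasoning
  s = inv √5
  A = ofℕ 2 ^ n ⊖ φ₋ ^ n
  B = ofℕ 2 ^ n ⊖ φ₊ ^ n
  a₀ = coeff′ (α n) (β n) n 0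
  split : ∀ T P Q a b →
    (one√5 ⊗ s) ⊗ (P ⊗ a ⊖ Q ⊗ b)
      ≡ (T ⊗ s) ⊗ (one√5 ⊗ a ⊖ one√5 ⊗ b) ⊖ s ⊗ ((T ⊖ P) ⊗ a ⊖ (T ⊖ Q) ⊗ b)
  split = solve-∀ ℚ√5-ring
  vanish : ∀ x → x ⊖ s ⊗ (one√5 ⊖ one√5) ≡ x
  vanish = solve-∀ ℚ√5-ring

-- By φ₊ + φ₋ = 6 and φ₊ φ₋ = 4, 3·2ⁿ − 2ⁿ⁻¹φ₋ − 2φ₋ⁿ⁻¹ = (φ₊/2)(2ⁿ − φ₋ⁿ) and symmetrically,
-- which leaves (φ₊ − φ₋)/(2√5) = 1.
coeff′-boundary : ∀ k → let n = suc k in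
  (ofℕ 2 ^ n ⊖ φ₋ ^ n) ⊗ α n ≡ one√5 → (ofℕ 2 ^ n ⊖ φ₊ ^ n) ⊗ β n ≡ one√5 →
  ofℕ 3 ⊗ coeff′ (α n) (β n) n 0 ⊖ coeff′ (α n) (β n) 1 k ⊖ coeff′ (α n) (β n) k 1 ≡ one√5
coeff′-boundary k Aα Bβ = begin
  ofℕ 3 ⊗ a n 0 ⊖ a 1 k ⊖ a k 1                  ≡⟨ factor (ofℕ 2 ^ k) (φ₋ ^ k) (φ₊ ^ k) (α n) (β n) ⟩
  (s ⊗ h) ⊗ (φ₊ ⊗ (A ⊗ α n) ⊖ φ₋ ⊗ (B ⊗ β n))    ≡⟨ cong₂ (λ u v → (s ⊗ h) ⊗ (φ₊ ⊗ u ⊖ φ₋ ⊗ v)) Aα Bβ ⟩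
  (s ⊗ h) ⊗ (φ₊ ⊗ one√5 ⊖ φ₋ ⊗ one√5)            ≡⟨⟩
  one√5                                          ∎
  where
  open ≡-Reasoning
  n = suc k
  s = inv √5
  h = inv (ofℕ 2)
  A = ofℕ 2 ^ n ⊖ φ₋ ^ n
  B = ofℕ 2 ^ n ⊖ φ₊ ^ n
  a = coeff′ (α n) (β n)
  factor : ∀ T P Q a b →
    ofℕ 3 ⊗ (((ofℕ 2 ⊗ T) ⊗ s) ⊗ (one√5 ⊗ a ⊖ one√5 ⊗ b))
      ⊖ ((ofℕ 2 ⊗ one√5) ⊗ s) ⊗ (P ⊗ a ⊖ Q ⊗ b)
      ⊖ (T ⊗ s) ⊗ ((φ₋ ⊗ one√5) ⊗ a ⊖ (φ₊ ⊗ one√5) ⊗ b)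
    ≡ (s ⊗ h) ⊗ (φ₊ ⊗ ((ofℕ 2 ⊗ T ⊖ φ₋ ⊗ P) ⊗ a) ⊖ φ₋ ⊗ ((ofℕ 2 ⊗ T ⊖ φ₊ ⊗ Q) ⊗ b))
  factor = solve-∀ ℚ√5-ring

2^⊖φ₋^-invertible : ∀ k → (ofℕ 2 ^ suc k ⊖ φ₋ ^ suc k) ⊗ α (suc k) ≡ one√5
2^⊖φ₋^-invertible k = ⊗-inverseʳ (ofℕ 2 ^ suc k ⊖ φ₋ ^ suc k) (ℚ.<⇒≢ (norm-2^⊖φ₋^-negative k))

2^⊖φ₊^-invertible : ∀ k → (ofℕ 2 ^ suc k ⊖ φ₊ ^ suc k) ⊗ β (suc k) ≡ one√5
2^⊖φ₊^-invertible k = ⊗-inverseʳ (ofℕ 2 ^ suc k ⊖ φ₊ ^ suc k) (ℚ.<⇒≢ (norm-2^⊖φ₊^-negative k))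

∸-suc : ∀ {j n} → suc j ≤ n → n ∸ j ≡ suc (n ∸ suc j)
∸-suc {zero}  (s≤s _)   = refl
∸-suc {suc j} (s≤s j<n) = ∸-suc j<n

coeff-recurrence : ∀ n e → 2 ℕ.+ e ≤ n →
  ofℕ 3 ⊗ coeff n (suc e) ⊖ coeff n e ⊖ coeff n (2 ℕ.+ e) ≡ zero√5
coeff-recurrence n e 2+e≤n =
  subst₂ (λ r r′ → ofℕ 3 ⊗ a r (suc e) ⊖ a r′ e ⊖ coeff n (2 ℕ.+ e) ≡ zero√5)
    (sym n∸[1+e]) (sym n∸e) (coeff′-recurrence (α n) (β n) (n ∸ (2 ℕ.+ e)) e)
  where
  a = coeff′ (α n) (β n)
  n∸[1+e] : n ∸ suc e ≡ suc (n ∸ (2 ℕ.+ e))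
  n∸[1+e] = ∸-suc 2+e≤n
  n∸e : n ∸ e ≡ 2 ℕ.+ (n ∸ (2 ℕ.+ e))
  n∸e = trans (∸-suc (ℕ.<⇒≤ 2+e≤n)) (cong suc n∸[1+e])

coeff-periodic : ∀ k → coeff (suc k) (suc k) ≡ coeff (suc k) 0
coeff-periodic k = trans (cong (λ e → coeff′ (α (suc k)) (β (suc k)) e (suc k)) (ℕ.n∸n≡0 k))
  (coeff′-periodic (suc k) (2^⊖φ₋^-invertible k) (2^⊖φ₊^-invertible k))

coeff-boundary : ∀ k → ofℕ 3 ⊗ coeff (suc k) 0 ⊖ coeff (suc k) k ⊖ coeff (suc k) 1 ≡ one√5
coeff-boundary k =
  subst (λ e → ofℕ 3 ⊗ coeff (suc k) 0 ⊖ coeff′ (α (suc k)) (β (suc k)) e k ⊖ coeff (suc k) 1 ≡ one√5)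
    (sym (ℕ.m+n∸n≡m 1 k)) (coeff′-boundary k (2^⊖φ₋^-invertible k) (2^⊖φ₊^-invertible k))

open CommutativeRing ℚ√5-commutativeRing using (+-group; zeroˡ)
open GroupProperties +-group using (∙-cancelˡ)

Σ-zero : ∀ n → Σ n (λ _ → zero√5) ≡ zero√5
Σ-zero zero    = refl
Σ-zero (suc n) = trans (cong (zero√5 ⊕_) (Σ-zero n)) (⊕-identityˡ zero√5)

Σ-cong< : ∀ n {f g : ℕ → ℚ√5} → (∀ k → k < n → f k ≡ g k) → Σ n (f ∘ toℕ) ≡ Σ n (g ∘ toℕ)
Σ-cong< zero    f≡g = refl
Σ-cong< (suc n) f≡g = cong₂ _⊕_ (f≡g 0 z<s) (Σ-cong< n (λ k k<n → f≡g (suc k) (s<s k<n)))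

Σ-last : ∀ n (f : ℕ → ℚ√5) → Σ (suc n) (f ∘ toℕ) ≡ Σ n (f ∘ toℕ) ⊕ f n
Σ-last zero    f = ⊕-comm (f 0) zero√5
Σ-last (suc n) f = trans (cong (f 0 ⊕_) (Σ-last n (f ∘ suc))) (sym (⊕-assoc (f 0) _ (f (suc n))))

Σ-shift : ∀ n (f : ℕ → ℚ√5) → f n ≡ f 0 → Σ n (f ∘ suc ∘ toℕ) ≡ Σ n (f ∘ toℕ)
Σ-shift n f fn≡f0 = ∙-cancelˡ (f 0) _ _ (begin
  Σ (suc n) (f ∘ toℕ)      ≡⟨ Σ-last n f ⟩
  Σ n (f ∘ toℕ) ⊕ f n      ≡⟨ cong (Σ n (f ∘ toℕ) ⊕_) fn≡f0 ⟩
  Σ n (f ∘ toℕ) ⊕ f 0      ≡⟨ ⊕-comm (Σ n (f ∘ toℕ)) (f 0) ⟩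
  f 0 ⊕ Σ n (f ∘ toℕ)      ∎)
  where open ≡-Reasoning

Σ-rotate : ∀ n (f : ℕ → ℚ√5) → (∀ x → f (x ℕ.+ n) ≡ f x) →
           ∀ s → Σ n (λ k → f (toℕ k ℕ.+ s)) ≡ Σ n (f ∘ toℕ)
Σ-rotate n f periodic zero    = Σ-cong< n (λ k _ → cong f (ℕ.+-identityʳ k))
Σ-rotate n f periodic (suc s) = begin
  Σ n (λ k → f (toℕ k ℕ.+ suc s))   ≡⟨ Σ-cong< n (λ k _ → cong f (ℕ.+-suc k s)) ⟩
  Σ n (λ k → f (suc (toℕ k) ℕ.+ s)) ≡⟨ Σ-shift n (λ x → f (x ℕ.+ s)) (trans (cong f (ℕ.+-comm n s)) (periodic s)) ⟩
  Σ n (λ k → f (toℕ k ℕ.+ s))       ≡⟨ Σ-rotate n f periodic s ⟩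
  Σ n (f ∘ toℕ)                   ∎
  where open ≡-Reasoning

Σ-reverse : ∀ m (g : ℕ → ℚ√5) → Σ m (λ l → g (m ∸ suc (toℕ l))) ≡ Σ m (g ∘ toℕ)
Σ-reverse zero    g = refl
Σ-reverse (suc m) g = begin
  g m ⊕ Σ m (λ l → g (m ∸ suc (toℕ l)))  ≡⟨ cong (g m ⊕_) (Σ-reverse m g) ⟩
  g m ⊕ Σ m (g ∘ toℕ)                    ≡⟨ ⊕-comm (g m) (Σ m (g ∘ toℕ)) ⟩
  Σ m (g ∘ toℕ) ⊕ g m                    ≡⟨ Σ-last m g ⟨
  Σ (suc m) (g ∘ toℕ)                    ∎
  where open ≡-Reasoning

-- Circulant matrices

module Cyclic (m : ℕ) where

  open import Data.Nat using (_+_)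

  n : ℕ
  n = suc m

  [n+x]%n≡x%n : ∀ x → (n + x) % n ≡ x % n
  [n+x]%n≡x%n x = trans (cong (_% n) (ℕ.+-comm n x)) ([m+n]%n≡m%n x n)

  -- (a − b) mod n for b ≤ n; circ n c i j is c (toℕ j ⊟ toℕ i) by definition.
  infixl 6 _⊟_
  _⊟_ : ℕ → ℕ → ℕ
  a ⊟ b = (n + a ∸ b) % n

  ⊟-cong : ∀ {a a′ b b′} → b ≤ n → b′ ≤ n → (a + b′) % n ≡ (a′ + b) % n → a ⊟ b ≡ a′ ⊟ b′
  ⊟-cong {a} {a′} {b} {b′} b≤n b′≤n eq = begin
    (n + a ∸ b) % n             ≡⟨ cong (_% n) (ℕ.+-∸-comm a b≤n) ⟩
    (x + a) % n                 ≡⟨ [m+n]%n≡m%n (x + a) n ⟨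
    ((x + a) + n) % n           ≡⟨ cong (λ z → ((x + a) + z) % n) (ℕ.m∸n+n≡m b′≤n) ⟨
    ((x + a) + (y + b′)) % n    ≡⟨ cong (_% n) (regroup x a y b′) ⟩
    ((x + y) + (a + b′)) % n    ≡⟨ %-distribˡ-+ (x + y) (a + b′) n ⟩
    ((x + y) % n + (a + b′) % n) % n ≡⟨ cong (λ z → ((x + y) % n + z) % n) eq ⟩
    ((x + y) % n + (a′ + b) % n) % n ≡⟨ %-distribˡ-+ (x + y) (a′ + b) n ⟨
    ((x + y) + (a′ + b)) % n    ≡⟨ cong (_% n) (regroup′ x y a′ b) ⟩
    ((y + a′) + (x + b)) % n    ≡⟨ cong (λ z → ((y + a′) + z) % n) (ℕ.m∸n+n≡m b≤n) ⟩
    ((y + a′) + n) % n          ≡⟨ [m+n]%n≡m%n (y + a′) n ⟩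
    (y + a′) % n                ≡⟨ cong (_% n) (ℕ.+-∸-comm a′ b′≤n) ⟨
    (n + a′ ∸ b′) % n           ∎
    where
    open ≡-Reasoning
    x = n ∸ b
    y = n ∸ b′
    regroup : ∀ x a y b′ → (x + a) + (y + b′) ≡ (x + y) + (a + b′)
    regroup = solve-∀ ℕ-ring
    regroup′ : ∀ x y a′ b → (x + y) + (a′ + b) ≡ (y + a′) + (x + b)
    regroup′ = solve-∀ ℕ-ring

  ⊟-zero : ∀ a → a ⊟ 0 ≡ a % n
  ⊟-zero a = [n+x]%n≡x%n a

  ⊟-+-cancelʳ : ∀ {b} l → b ≤ n → (l + b) % n ⊟ b ≡ l % n
  ⊟-+-cancelʳ {b} l b≤n =
    trans (⊟-cong b≤n z≤n (trans (cong (_% n) (ℕ.+-identityʳ ((l + b) % n))) (m%n%n≡m%n (l + b) n)))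
          (⊟-zero l)

  ⊟-+-assoc : ∀ {b} a l → b ≤ n → l ≤ n → a ⊟ (l + b) % n ≡ a ⊟ b ⊟ l
  ⊟-+-assoc {b} a l b≤n l≤n = ⊟-cong (m%n≤n (l + b) n) l≤n (begin
    (a + l) % n                   ≡⟨ [n+x]%n≡x%n (a + l) ⟨
    (n + (a + l)) % n             ≡⟨ cong (_% n) (ℕ.+-assoc n a l) ⟨
    ((n + a) + l) % n             ≡⟨ cong (λ z → (z + l) % n) (ℕ.m∸n+n≡m (ℕ.≤-trans b≤n (ℕ.m≤m+n n a))) ⟨
    ((n + a ∸ b + b) + l) % n     ≡⟨ cong (_% n) (regroup (n + a ∸ b) b l) ⟩
    ((n + a ∸ b) + (l + b)) % n   ≡⟨ %-distribˡ-+ (n + a ∸ b) (l + b) n ⟩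
    (a ⊟ b + (l + b) % n) % n     ∎)
    where
    open ≡-Reasoning
    regroup : ∀ x b l → (x + b) + l ≡ x + (l + b)
    regroup = solve-∀ ℕ-ring

  ⊟-self : ∀ a → a ⊟ a ≡ 0
  ⊟-self a = trans (cong (_% n) (ℕ.m+n∸n≡m n a)) (n%n≡0 n)

  ⊟≡0⇒≡ : ∀ {a b} → a < n → b < n → a ⊟ b ≡ 0 → b ≡ a
  ⊟≡0⇒≡ {a} {b} a<n b<n a⊟b≡0 = begin
    b                         ≡⟨ m<n⇒m%n≡m b<n ⟨
    b % n                     ≡⟨ m%n%n≡m%n b n ⟨
    (0 + b % n) % n           ≡⟨ cong (λ z → (z + b % n) % n) a⊟b≡0 ⟨
    (a ⊟ b + b % n) % n       ≡⟨ %-distribˡ-+ (n + a ∸ b) b n ⟨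
    ((n + a ∸ b) + b) % n     ≡⟨ cong (_% n) (ℕ.m∸n+n≡m (ℕ.≤-trans (ℕ.<⇒≤ b<n) (ℕ.m≤m+n n a))) ⟩
    (n + a) % n               ≡⟨ [n+x]%n≡x%n a ⟩
    a % n                     ≡⟨ m<n⇒m%n≡m a<n ⟩
    a                         ∎
    where open ≡-Reasoning

  ⊟-+-cancelˡ : ∀ a l → a ≤ n → l ≤ n → a ⊟ (l + a) % n ≡ 0 ⊟ l
  ⊟-+-cancelˡ a l a≤n l≤n = trans (⊟-+-assoc a l a≤n l≤n) (cong (_⊟ l) (⊟-self a))

  [a+b%n]%n≡[a+b]%n : ∀ a b → (a + b % n) % n ≡ (a + b) % n
  [a+b%n]%n≡[a+b]%n a b = begin
    (a + b % n) % n          ≡⟨ %-distribˡ-+ a (b % n) n ⟩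
    (a % n + b % n % n) % n  ≡⟨ cong (λ z → (a % n + z) % n) (m%n%n≡m%n b n) ⟩
    (a % n + b % n) % n      ≡⟨ %-distribˡ-+ a b n ⟨
    (a + b) % n              ∎
    where open ≡-Reasoning

  ⊟-neg : ∀ a l → l ≤ n → a ⊟ (0 ⊟ l) ≡ (l + a) % n
  ⊟-neg a l l≤n = trans (⊟-cong (m%n≤n (n + 0 ∸ l) n) z≤n (begin
    (a + 0) % n                      ≡⟨ cong (_% n) (ℕ.+-identityʳ a) ⟩
    a % n                            ≡⟨ [m+n]%n≡m%n a n ⟨
    (a + n) % n                      ≡⟨ cong (λ z → (a + z) % n) (ℕ.+-identityʳ n) ⟨
    (a + (n + 0)) % n                ≡⟨ cong (λ z → (a + z) % n) (ℕ.m∸n+n≡m (ℕ.≤-trans l≤n (ℕ.m≤m+n n 0))) ⟨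
    (a + ((n + 0 ∸ l) + l)) % n      ≡⟨ cong (_% n) (regroup a l (n + 0 ∸ l)) ⟩
    ((l + a) + (n + 0 ∸ l)) % n      ≡⟨ [a+b%n]%n≡[a+b]%n (l + a) (n + 0 ∸ l) ⟨
    ((l + a) + (0 ⊟ l)) % n          ∎)) (⊟-zero (l + a))
    where
    open ≡-Reasoning
    regroup : ∀ a l x → a + (x + l) ≡ (l + a) + x
    regroup = solve-∀ ℕ-ring

  Σ-reflect : ∀ (f : ℕ → ℚ√5) → Σ n (λ l → f (0 ⊟ toℕ l)) ≡ Σ n (f ∘ toℕ)
  Σ-reflect f = cong₂ _⊕_ (cong f (⊟-zero 0))
    (trans (Σ-cong< m (λ l l<m → cong f (0⊟suc l<m))) (Σ-reverse m (f ∘ suc)))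
    where
    0⊟suc : ∀ {l} → l < m → 0 ⊟ suc l ≡ suc (m ∸ suc l)
    0⊟suc {l} l<m = begin
      (m + 0 ∸ l) % n    ≡⟨ cong (λ z → (z ∸ l) % n) (ℕ.+-identityʳ m) ⟩
      (m ∸ l) % n        ≡⟨ m<n⇒m%n≡m (ℕ.s≤s (ℕ.m∸n≤m m l)) ⟩
      m ∸ l              ≡⟨ ∸-suc l<m ⟩
      suc (m ∸ suc l)    ∎
      where open ≡-Reasoning

  conv : (ℕ → ℚ√5) → (ℕ → ℚ√5) → ℕ → ℚ√5
  conv c e d = Σ n (λ l → c (toℕ l) ⊗ e (d ⊟ toℕ l))

  circ-·-circ : ∀ c e (i j : Fin n) → (circ n c · circ n e) i j ≡ circ n (conv c e) i j
  circ-·-circ c e i j = begin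
    Σ n (F ∘ toℕ)                        ≡⟨ Σ-cong< n (λ k k<n → cong F (m<n⇒m%n≡m k<n)) ⟨
    Σ n (λ k → F (toℕ k % n))            ≡⟨ Σ-rotate n (F ∘ (_% n)) (λ x → cong F ([m+n]%n≡m%n x n)) I ⟨
    Σ n (λ l → F ((toℕ l + I) % n))      ≡⟨ Σ-cong< n (λ l l<n → cong₂ (λ u v → c u ⊗ e v)
                                              (trans (⊟-+-cancelʳ l I≤n) (m<n⇒m%n≡m l<n))
                                              (⊟-+-assoc J l I≤n (ℕ.<⇒≤ l<n))) ⟩
    conv c e (J ⊟ I)                     ∎
    where
    open ≡-Reasoning
    I = toℕ i
    J = toℕ j
    I≤n : I ≤ n
    I≤n = ℕ.<⇒≤ (Fin.toℕ<n i)
    F : ℕ → ℚ√5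
    F x = c (x ⊟ I) ⊗ e (J ⊟ x)

  conv-comm : ∀ c e d → d ≤ n → conv c e d ≡ conv e c d
  conv-comm c e d d≤n = begin
    Σ n (G ∘ toℕ)                         ≡⟨ Σ-cong< n (λ l l<n → cong G (m<n⇒m%n≡m l<n)) ⟨
    Σ n (λ l → G (toℕ l % n))             ≡⟨ Σ-rotate n (G ∘ (_% n)) (λ x → cong G ([m+n]%n≡m%n x n)) d ⟨
    Σ n (λ l → G ((toℕ l + d) % n))       ≡⟨ Σ-cong< n (λ l l<n → cong₂ (λ u v → c u ⊗ e v)
                                               (sym (⊟-neg d l (ℕ.<⇒≤ l<n)))
                                               (⊟-+-cancelˡ d l d≤n (ℕ.<⇒≤ l<n))) ⟩
    Σ n (λ l → H (0 ⊟ toℕ l))             ≡⟨ Σ-reflect H ⟩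
    Σ n (H ∘ toℕ)                         ≡⟨ Σ-cong< n (λ l _ → ⊗-comm (c (d ⊟ l)) (e l)) ⟩
    conv e c d                            ∎
    where
    open ≡-Reasoning
    G H : ℕ → ℚ√5
    G x = c x ⊗ e (d ⊟ x)
    H y = c (d ⊟ y) ⊗ e y

  e₀ : ℕ → ℚ√5
  e₀ zero    = one√5
  e₀ (suc _) = zero√5

  identity≡circ : ∀ (i j : Fin n) → identity n i j ≡ circ n e₀ i j
  identity≡circ i j with toℕ i ℕ.≟ toℕ j
  ... | yes I≡J = cong e₀ (sym (trans (cong (toℕ j ⊟_) I≡J) (⊟-self (toℕ j))))
  ... | no  I≢J with toℕ j ⊟ toℕ i in J⊟I
  ...   | zero  = contradiction (⊟≡0⇒≡ (Fin.toℕ<n j) (Fin.toℕ<n i) J⊟I) I≢J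
  ...   | suc _ = refl

  circ-cong : ∀ {f g} → (∀ d → d < n → f d ≡ g d) → ∀ i j → circ n f i j ≡ circ n g i j
  circ-cong f≡g i j = f≡g (toℕ j ⊟ toℕ i) (m%n<n (n + toℕ j ∸ toℕ i) n)

row3-zero : ∀ n k → k ≢ 0 → k ≢ 1 → k ≢ n ∸ 1 → row3 n k ≡ zero√5
row3-zero n k k≢0 k≢1 k≢n-1 with k ℕ.≟ 0
... | yes k≡0 = contradiction k≡0 k≢0
... | no _ with k ℕ.≟ 1
...   | yes k≡1 = contradiction k≡1 k≢1
...   | no _ with k ℕ.≟ (n ∸ 1)
...     | yes k≡n-1 = contradiction k≡n-1 k≢n-1
...     | no _      = refl

row3-last : ∀ n → n ∸ 1 ≢ 0 → n ∸ 1 ≢ 1 → row3 n (n ∸ 1) ≡ ⊝ one√5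
row3-last n ≢0 ≢1 with (n ∸ 1) ℕ.≟ 0
... | yes ≡0 = contradiction ≡0 ≢0
... | no _ with (n ∸ 1) ℕ.≟ 1
...   | yes ≡1 = contradiction ≡1 ≢1
...   | no _ with (n ∸ 1) ℕ.≟ (n ∸ 1)
...     | yes _   = refl
...     | no ≢n-1 = contradiction refl ≢n-1

Σ-row3 : ∀ k (f : ℕ → ℚ√5) → let n = 3 ℕ.+ k in
         Σ n (λ l → row3 n (toℕ l) ⊗ f (toℕ l)) ≡ ofℕ 3 ⊗ f 0 ⊖ f 1 ⊖ f (2 ℕ.+ k)
Σ-row3 k f = begin
  outer (Σ (suc k) (g ∘ toℕ))         ≡⟨ cong outer (Σ-last k g) ⟩
  outer (Σ k (g ∘ toℕ) ⊕ g k)         ≡⟨ cong outer (cong₂ _⊕_ middle last) ⟩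
  outer (zero√5 ⊕ ⊝ one√5 ⊗ f m)      ≡⟨ collect (f 0) (f 1) (f m) ⟩
  ofℕ 3 ⊗ f 0 ⊖ f 1 ⊖ f m             ∎
  where
  open ≡-Reasoning
  n m : ℕ
  n = 3 ℕ.+ k
  m = 2 ℕ.+ k
  outer : ℚ√5 → ℚ√5
  outer x = ofℕ 3 ⊗ f 0 ⊕ (⊝ one√5 ⊗ f 1 ⊕ x)
  g : ℕ → ℚ√5
  g l = row3 n (2 ℕ.+ l) ⊗ f (2 ℕ.+ l)
  row3-middle : ∀ l → l < k → row3 n (2 ℕ.+ l) ≡ zero√5
  row3-middle l l<k = row3-zero n (2 ℕ.+ l) (λ ()) (λ ())
    (λ 2+l≡2+k → ℕ.<-irrefl (ℕ.suc-injective (ℕ.suc-injective 2+l≡2+k)) l<k)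
  middle : Σ k (g ∘ toℕ) ≡ zero√5
  middle = trans (Σ-cong< k (λ l l<k → trans (cong (_⊗ f (2 ℕ.+ l)) (row3-middle l l<k)) (zeroˡ (f (2 ℕ.+ l)))))
                 (Σ-zero k)
  last : g k ≡ ⊝ one√5 ⊗ f m
  last = cong (_⊗ f m) (row3-last n (λ ()) (λ ()))
  collect : ∀ a b c → ofℕ 3 ⊗ a ⊕ (⊝ one√5 ⊗ b ⊕ (zero√5 ⊕ ⊝ one√5 ⊗ c)) ≡ ofℕ 3 ⊗ a ⊖ b ⊖ c
  collect = solve-∀ ℚ√5-ring

module _ (k : ℕ) where
  open import Data.Nat using (_+_)
  open Cyclic (2 + k)

  private
    m : ℕ
    m = 2 + k
    C : ℕ → ℚ√5
    C = coeff n

  suc⊟1 : ∀ e → e < n → suc e ⊟ 1 ≡ e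
  suc⊟1 e e<n = trans (cong (_% n) (ℕ.+-suc m e)) (trans ([n+x]%n≡x%n e) (m<n⇒m%n≡m e<n))

  coeff-cyclic-interior : ∀ e → 2 + e ≤ m → ofℕ 3 ⊗ C (suc e) ⊖ C (suc e ⊟ 1) ⊖ C ((2 + e) % n) ≡ zero√5
  coeff-cyclic-interior e 2+e≤m = begin
    ofℕ 3 ⊗ C (suc e) ⊖ C (suc e ⊟ 1) ⊖ C ((2 + e) % n)
      ≡⟨ cong₂ (λ p s → ofℕ 3 ⊗ C (suc e) ⊖ C p ⊖ C s)
               (suc⊟1 e (ℕ.m≤n⇒m≤1+n (ℕ.<⇒≤ 2+e≤m))) (m<n⇒m%n≡m (s≤s 2+e≤m)) ⟩
    ofℕ 3 ⊗ C (suc e) ⊖ C e ⊖ C (2 + e)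
      ≡⟨ coeff-recurrence n e (ℕ.m≤n⇒m≤1+n 2+e≤m) ⟩
    zero√5
      ∎
    where open ≡-Reasoning

  coeff-cyclic-last : ofℕ 3 ⊗ C m ⊖ C (m ⊟ 1) ⊖ C (suc m % n) ≡ zero√5
  coeff-cyclic-last = begin
    ofℕ 3 ⊗ C m ⊖ C (m ⊟ 1) ⊖ C (n % n)
      ≡⟨ cong₂ (λ p c → ofℕ 3 ⊗ C m ⊖ C p ⊖ c)
               (suc⊟1 (suc k) (ℕ.n≤1+n m)) (trans (cong C (n%n≡0 n)) (sym (coeff-periodic m))) ⟩
    ofℕ 3 ⊗ C m ⊖ C (suc k) ⊖ C n
      ≡⟨ coeff-recurrence n (suc k) ℕ.≤-refl ⟩
    zero√5
      ∎
    where open ≡-Reasoning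

  coeff-cyclic-recurrence : ∀ d → d < n → ofℕ 3 ⊗ C d ⊖ C (d ⊟ 1) ⊖ C (suc d % n) ≡ e₀ d
  coeff-cyclic-recurrence zero _ =
    trans (cong (λ p → ofℕ 3 ⊗ C 0 ⊖ C p ⊖ C 1) 0⊟1) (coeff-boundary m)
    where
    0⊟1 : 0 ⊟ 1 ≡ m
    0⊟1 = trans (cong (_% n) (ℕ.+-identityʳ m)) (m<n⇒m%n≡m (ℕ.n<1+n m))
  coeff-cyclic-recurrence (suc e) (s≤s 1+e≤m) =
    [ coeff-cyclic-interior e , (λ { refl → coeff-cyclic-last }) ]′ (ℕ.m≤n⇒m<n∨m≡n 1+e≤m)

  conv-row3-coeff : ∀ d → d < n → conv (row3 n) C d ≡ e₀ d
  conv-row3-coeff d d<n = begin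
    conv (row3 n) C d                            ≡⟨ Σ-row3 k (λ l → C (d ⊟ l)) ⟩
    ofℕ 3 ⊗ C (d ⊟ 0) ⊖ C (d ⊟ 1) ⊖ C (d ⊟ m)   ≡⟨ cong₂ (λ a b → ofℕ 3 ⊗ C a ⊖ C (d ⊟ 1) ⊖ C b) d⊟0 d⊟m ⟩
    ofℕ 3 ⊗ C d ⊖ C (d ⊟ 1) ⊖ C (suc d % n)      ≡⟨ coeff-cyclic-recurrence d d<n ⟩
    e₀ d                                         ∎
    where
    open ≡-Reasoning
    d⊟0 : d ⊟ 0 ≡ d
    d⊟0 = trans (⊟-zero d) (m<n⇒m%n≡m d<n)
    d⊟m : d ⊟ m ≡ suc d % n
    d⊟m = cong (_% n) (trans (cong (_∸ m) (sym (ℕ.+-suc m d))) (ℕ.m+n∸m≡n m (suc d)))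

mainTheorem7 : ∀ (n : ℕ) → 3 < n →
    ((ofℕ 2 ^ n) ⊖ (φ₋ ^ n) ≢ zero√5) × ((ofℕ 2 ^ n) ⊖ (φ₊ ^ n) ≢ zero√5) ×
    (∀ (i j : Fin n) → (circ n (row3 n) · circ n (coeff n)) i j ≡ identity n i j) ×
    (∀ (i j : Fin n) → (circ n (coeff n) · circ n (row3 n)) i j ≡ identity n i j)
mainTheorem7 (suc (suc (suc (suc t)))) (s≤s (s≤s (s≤s (s≤s _)))) =
  norm-negative⇒≢0 (norm-2^⊖φ₋^-negative (3 ℕ.+ t)) ,
  norm-negative⇒≢0 (norm-2^⊖φ₊^-negative (3 ℕ.+ t)) ,
  R·C≡I , C·R≡I
  where
  open Cyclic (3 ℕ.+ t)
  R C : ℕ → ℚ√5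
  R = row3 n
  C = coeff n
  open ≡-Reasoning
  R·C≡I : ∀ i j → (circ n R · circ n C) i j ≡ identity n i j
  R·C≡I i j = begin
    (circ n R · circ n C) i j   ≡⟨ circ-·-circ R C i j ⟩
    circ n (conv R C) i j       ≡⟨ circ-cong (conv-row3-coeff (suc t)) i j ⟩
    circ n e₀ i j               ≡⟨ identity≡circ i j ⟨
    identity n i j              ∎
  C·R≡I : ∀ i j → (circ n C · circ n R) i j ≡ identity n i j
  C·R≡I i j = begin
    (circ n C · circ n R) i j   ≡⟨ circ-·-circ C R i j ⟩
    circ n (conv C R) i j       ≡⟨ circ-cong (λ d d<n → trans (conv-comm C R d (ℕ.<⇒≤ d<n))
                                                             (conv-row3-coeff (suc t) d d<n)) i j ⟩
    circ n e₀ i j               ≡⟨ identity≡circ i j ⟨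
    identity n i j              ∎
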